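{- Let $f:\mathbb{N}\to\mathbb{N}$ satisfy $f(n)\to\infty$ as $n\to\infty$. Suppose that for every integer $d\ge0$, $\lim_{k\to\infty} M_{f,k}(d) = L_f(d)$, and that $f(n+1) < \frac{3}{2} f(n)$ for all sufficiently large $n$. Then \[ N_{f,d} \geq \lfloor \log_2(d) \rfloor + 1 \] for all sufficiently large $d$.
   Context: $\mathbb{N}=\{1,2,3,\dots\}$. $\Delta_{f,k}(n) := \min\{|f(n) - m^k| : m \in \mathbb{Z}\}$. For $d\ge0$: $M_{f,k}(d) := \max\{n \in \mathbb{N} : \Delta_{f,k}(n) \le d\}$ (or $\infty$ if no maximum exists); $L_f(d) := \max\{n\in\mathbb{N} : f(n) \le d+1\}$ (or $\infty$ if no maximum exists); and $N_{f,d} := \min\{ n \in \mathbb{N} : M_{f,k}(d) = L_f(d) \text{ for all } k \geq n \}$. -}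

module Defs where

open import Data.Nat using (ℕ; suc; _≤_; _+_)
open import Data.Integer as ℤ using (ℤ; +_; _-_; _^_; ∣_∣)
open import Data.Product using (Σ; _×_; ∃)
open import Function.Bundles using (_⇔_)

-- Domain ℕ = {1,2,3,...} is modelled by ℕ with explicit "1 ≤ n" guards;
-- the value f 0 is never used.

-- Δ_{f,k}(n) ≤ d  :  min over m ∈ ℤ of |f(n) - m^k| is ≤ d,
-- i.e. some integer m has |f(n) - m^k| ≤ d (the minimum is attained).
ΔLe : (ℕ → ℕ) → ℕ → ℕ → ℕ → Set
ΔLe f k d n = ∃ λ (m : ℤ) → ∣ (+ f n) - m ^ k ∣ ≤ d

IsMax : (ℕ → Set) → ℕ → Set
IsMax P m = (1 ≤ m × P m) × (∀ n → 1 ≤ n → P n → n ≤ m)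

MSet : (ℕ → ℕ) → ℕ → ℕ → ℕ → Set
MSet f k d n = ΔLe f k d n

LSet : (ℕ → ℕ) → ℕ → ℕ → Set
LSet f d n = f n ≤ suc d

-- M_{f,k}(d) = L_f(d) : the two sets have the same maximum
-- (as extended values: one has maximum m iff the other does).
MEqL : (ℕ → ℕ) → ℕ → ℕ → Set
MEqL f k d = ∀ m → IsMax (MSet f k d) m ⇔ IsMax (LSet f d) m

GoodFrom : (ℕ → ℕ) → ℕ → ℕ → Set
GoodFrom f d n = ∀ k → n ≤ k → MEqL f k d

IsN : (ℕ → ℕ) → ℕ → ℕ → Set
IsN f d N = (1 ≤ N × GoodFrom f d N) × (∀ n → 1 ≤ n → GoodFrom f d n → N ≤ n)

TendsToInfinity : (ℕ → ℕ) → Set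
TendsToInfinity f = ∀ B → ∃ λ n₀ → ∀ n → n₀ ≤ n → B ≤ f n

{-# OPTIONS --safe #-}
-- Let L = L_f(d) and k = ⌊log₂ d⌋, so that 2^k ≤ d < 2^(k+1). Maximality of L gives f(L+1) > d+1,
-- and the growth condition at L gives 2 f(L+1) < 3 f(L) ≤ 3(d+1); hence |f(L+1) − 2^k| ≤ d.
-- So L+1 lies in the set defining M_{f,k}(d), which therefore differs from L_f(d), and N_{f,d} > k.
-- Taking d > f(n₀+1) makes L > n₀, so that the growth condition does apply at L.
module Submission where

open import Defs
open import Data.Nat using (ℕ; suc; _≤_; _<_; _*_; _+_)
open import Data.Nat.Logarithm using (⌊log₂_⌋)
open import Data.Product using (Σ; _×_; ∃)

open import Data.Nat using (zero; _∸_; _^_; z≤n; s≤s; _≤?_; ⌊_/2⌋; ⌈_/2⌉; >-nonZero)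
open import Data.Nat.Properties
open import Data.Nat.Induction using (<-rec)
open import Data.Nat.Logarithm using (⌊log₂⌋-mono-≤; ⌊log₂⌊n/2⌋⌋≡⌊log₂n⌋∸1; ⌊log₂[2^n]⌋≡n)
open import Data.Integer as ℤ using (+_; _-_; ∣_∣)
import Data.Integer.Properties as ℤ
open import Data.Product using (_,_; proj₂)
open import Data.Sum using (inj₁; inj₂)
open import Data.Empty using (⊥-elim)
open import Function.Bundles using (Equivalence)
open import Relation.Nullary using (¬_; yes; no)
open import Relation.Unary using (Pred; Decidable)
open import Relation.Binary.PropositionalEquality

greatest-witness : ∀ {ℓ} {P : Pred ℕ ℓ} → Decidable P → ∀ b → (∀ n → b ≤ n → ¬ P n) →
                   ∀ {a} → P a → ∃ λ m → a ≤ m × P m × (∀ n → P n → n ≤ m)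
greatest-witness P? zero    none {a} Pa = ⊥-elim (none a z≤n Pa)
greatest-witness {P = P} P? (suc b) none Pa with P? b
... | yes Pb  = b , below Pa , Pb , λ _ → below
  where
  below : ∀ {n} → P n → n ≤ b
  below {n} Pn = ≮⇒≥ λ b<n → none n b<n Pn
... | no  ¬Pb = greatest-witness P? b none′ Pa
  where
  none′ : ∀ n → b ≤ n → ¬ P n
  none′ n b≤n Pn with m≤n⇒m<n∨m≡n b≤n
  ... | inj₁ b<n  = none n b<n Pn
  ... | inj₂ refl = ¬Pb Pn

⌊log₂n⌋≡1+⌊log₂⌊n/2⌋⌋ : ∀ n → 2 ≤ n → ⌊log₂ n ⌋ ≡ suc ⌊log₂ ⌊ n /2⌋ ⌋
⌊log₂n⌋≡1+⌊log₂⌊n/2⌋⌋ n 2≤n = begin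
  ⌊log₂ n ⌋                ≡⟨ sym (suc-pred ⌊log₂ n ⌋ {{>-nonZero (⌊log₂⌋-mono-≤ 2≤n)}}) ⟩
  suc (⌊log₂ n ⌋ ∸ 1)      ≡⟨ cong suc (sym (⌊log₂⌊n/2⌋⌋≡⌊log₂n⌋∸1 n)) ⟩
  suc ⌊log₂ ⌊ n /2⌋ ⌋      ∎
  where open ≡-Reasoning

2*⌊n/2⌋≤n : ∀ n → 2 * ⌊ n /2⌋ ≤ n
2*⌊n/2⌋≤n n = begin
  2 * ⌊ n /2⌋         ≡⟨ cong (_+_ ⌊ n /2⌋) (+-identityʳ ⌊ n /2⌋) ⟩
  ⌊ n /2⌋ + ⌊ n /2⌋   ≤⟨ +-monoʳ-≤ ⌊ n /2⌋ (⌊n/2⌋≤⌈n/2⌉ n) ⟩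
  ⌊ n /2⌋ + ⌈ n /2⌉   ≡⟨ ⌊n/2⌋+⌈n/2⌉≡n n ⟩
  n                   ∎
  where open ≤-Reasoning

2^⌊log₂n⌋≤n : ∀ n → 1 ≤ n → 2 ^ ⌊log₂ n ⌋ ≤ n
2^⌊log₂n⌋≤n = <-rec _ step
  where
  step : ∀ n → (∀ {m} → m < n → 1 ≤ m → 2 ^ ⌊log₂ m ⌋ ≤ m) → 1 ≤ n → 2 ^ ⌊log₂ n ⌋ ≤ n
  step 1 _ _ = ≤-refl
  step n@(suc m@(suc _)) ih _ = begin
    2 ^ ⌊log₂ n ⌋             ≡⟨ cong (2 ^_) (⌊log₂n⌋≡1+⌊log₂⌊n/2⌋⌋ n (s≤s (s≤s z≤n))) ⟩
    2 * 2 ^ ⌊log₂ ⌊ n /2⌋ ⌋   ≤⟨ *-monoʳ-≤ 2 (ih (⌊n/2⌋<n m) (s≤s z≤n)) ⟩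
    2 * ⌊ n /2⌋               ≤⟨ 2*⌊n/2⌋≤n n ⟩
    n                         ∎
    where open ≤-Reasoning

n<2^[1+⌊log₂n⌋] : ∀ n → n < 2 ^ suc ⌊log₂ n ⌋
n<2^[1+⌊log₂n⌋] n with 2 ^ suc ⌊log₂ n ⌋ ≤? n
... | no  2^[1+k]≰n = ≰⇒> 2^[1+k]≰n
... | yes 2^[1+k]≤n = ⊥-elim (1+n≰n (subst (_≤ ⌊log₂ n ⌋) (⌊log₂[2^n]⌋≡n _) (⌊log₂⌋-mono-≤ 2^[1+k]≤n)))

pos-^ : ∀ m n → + (m ^ n) ≡ (+ m) ℤ.^ n
pos-^ m zero    = refl
pos-^ m (suc n) = trans (ℤ.pos-* m (m ^ n)) (cong ((+ m) ℤ.*_) (pos-^ m n))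

∣[+m]-[+n]∣≡m∸n : ∀ {m n} → n ≤ m → ∣ + m - + n ∣ ≡ m ∸ n
∣[+m]-[+n]∣≡m∸n {m} {n} n≤m = cong ∣_∣ (trans (ℤ.[+m]-[+n]≡m⊖n m n) (ℤ.⊖-≥ n≤m))

∣x-p∣≤d : ∀ {x p d} → p ≤ d → d < 2 * p → d < x → 2 * x < 3 * suc d → ∣ + x - + p ∣ ≤ d
∣x-p∣≤d {x} {p} {d} p≤d d<2p d<x 2x<3[1+d] =
  subst (_≤ d) (sym (∣[+m]-[+n]∣≡m∸n (≤-trans p≤d (<⇒≤ d<x)))) (m≤n+o⇒m∸n≤o x p x≤p+d)
  where
  2x<2[p+1+d] : 2 * x < 2 * (p + suc d)
  2x<2[p+1+d] = begin-strict
    2 * x                <⟨ 2x<3[1+d] ⟩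
    3 * suc d            ≡⟨⟩
    suc d + 2 * suc d    ≤⟨ +-monoˡ-≤ (2 * suc d) d<2p ⟩
    2 * p + 2 * suc d    ≡⟨ sym (*-distribˡ-+ 2 p (suc d)) ⟩
    2 * (p + suc d)      ∎
    where open ≤-Reasoning
  x≤p+d : x ≤ p + d
  x≤p+d = m<1+n⇒m≤n (subst (x <_) (+-suc p d) (*-cancelˡ-< 2 x (p + suc d) 2x<2[p+1+d]))

module _ {f : ℕ → ℕ} where

  LSet-hasMax : TendsToInfinity f → ∀ {d a} → 1 ≤ a → LSet f d a →
                ∃ λ L → a ≤ L × IsMax (LSet f d) L
  LSet-hasMax f→∞ {d} 1≤a fa≤1+d
    with n₁ , large ← f→∞ (suc (suc d))
    with L , a≤L , fL≤1+d , maximal ← greatest-witness (λ n → f n ≤? suc d) n₁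
           (λ n n₁≤n fn≤1+d → 1+n≰n (≤-trans (large n n₁≤n) fn≤1+d)) fa≤1+d
    = L , a≤L , (≤-trans 1≤a a≤L , fL≤1+d) , λ n _ → maximal n

  suc-L∈MSet[⌊log₂d⌋] : ∀ {d L} → IsMax (LSet f d) L → 2 * f (suc L) < 3 * f L → 1 ≤ d →
                        MSet f ⌊log₂ d ⌋ d (suc L)
  suc-L∈MSet[⌊log₂d⌋] {d} {L} ((_ , fL≤1+d) , maximal) growth 1≤d =
    + 2 , subst (λ z → ∣ + f (suc L) - z ∣ ≤ d) (pos-^ 2 ⌊log₂ d ⌋)
      (∣x-p∣≤d (2^⌊log₂n⌋≤n d 1≤d) (n<2^[1+⌊log₂n⌋] d) d<f[1+L]
               (<-≤-trans growth (*-monoʳ-≤ 3 fL≤1+d)))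
    where
    d<f[1+L] : d < f (suc L)
    d<f[1+L] = <-trans (n<1+n d) (≰⇒> λ f[1+L]≤1+d → 1+n≰n (maximal (suc L) (s≤s z≤n) f[1+L]≤1+d))

  MSet-beyond-max⇒¬MEqL : ∀ {k d L} → IsMax (LSet f d) L → MSet f k d (suc L) → ¬ MEqL f k d
  MSet-beyond-max⇒¬MEqL {L = L} maxL δ M≡L =
    1+n≰n (proj₂ (Equivalence.from (M≡L L) maxL) (suc L) (s≤s z≤n) δ)

theorem4p1 : (f : ℕ → ℕ) → (∀ n → 1 ≤ n → 1 ≤ f n) → TendsToInfinity f
    → (∀ d → ∃ λ K → GoodFrom f d K)
    → (∃ λ n₀ → ∀ n → n₀ ≤ n → 2 * f (suc n) < 3 * f n)
    → ∃ λ D → ∀ d → D ≤ d → ∀ N → IsN f d N → ⌊log₂ d ⌋ + 1 ≤ N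
theorem4p1 f _ f→∞ _ (n₀ , growth) = suc (f (suc n₀)) , bound
  where
  bound : ∀ d → suc (f (suc n₀)) ≤ d → ∀ N → IsN f d N → ⌊log₂ d ⌋ + 1 ≤ N
  bound d f[1+n₀]<d N ((_ , goodN) , _)
    with L , 1+n₀≤L , maxL ← LSet-hasMax f→∞ (s≤s z≤n) (m≤n⇒m≤1+n (<⇒≤ f[1+n₀]<d))
    = ≮⇒≥ λ N<k+1 → M≢L (goodN ⌊log₂ d ⌋ (m<1+n⇒m≤n (subst (N <_) (+-comm _ 1) N<k+1)))
    where
    M≢L : ¬ MEqL f ⌊log₂ d ⌋ d
    M≢L = MSet-beyond-max⇒¬MEqL {k = ⌊log₂ d ⌋} maxL
      (suc-L∈MSet[⌊log₂d⌋] maxL (growth L (<⇒≤ 1+n₀≤L)) (≤-trans (s≤s z≤n) f[1+n₀]<d))
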